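{- Let $r$ be a 64-bit integer and $p=2^{64}\oplus r$. For any non-negative integer $x$, letting $z=(x\div 2^{64})\star r$, we have $$x\bmod p=\big((z\div 2^{64})\star 2^{64}\big)\bmod p\;\oplus\; z\bmod 2^{64}\;\oplus\; x\bmod 2^{64}.$$
   Context: $\oplus$ is bitwise XOR. The carry-less product $a\star b$ of non-negative integers is the integer whose $i$-th least significant bit is $\bigoplus_{k=0}^{i}a_{i-k}b_k$, where $a_j$ is the $j$-th least significant bit of $a$. For $b\ne0$, $\mathrm{degree}(b)$ is the index of its most significant nonzero bit; for $a$ and $b\neq 0$ there are unique $\alpha,\beta$ with $a=(\alpha\star b)\oplus\beta$ and $\beta=0$ or $\mathrm{degree}(\beta)<\mathrm{degree}(b)$, and $a\div b=\alpha$, $a\bmod b=\beta$ denote these carry-less quotient and remainder (for $b$ a power of two they coincide with ordinary integer quotient and remainder). Operators $\star$, $\bmod$, $\div$ bind tighter than $\oplus$ and are evaluated left to right. -}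

module Defs where

open import Data.Nat using (ℕ; zero; suc; _+_; _*_; _∸_; _^_; _<ᵇ_; _≡ᵇ_)
open import Data.Nat.DivMod using (_/_; _%_)
open import Data.Nat.Logarithm using (⌊log₂_⌋)
open import Data.Bool using (Bool; true; false; if_then_else_)
open import Data.Product using (_×_; _,_; proj₁; proj₂)

-- Bitwise XOR on ℕ (fuel argument ≥ number of bits needed; fuel = a + b suffices).
xorF : ℕ → ℕ → ℕ → ℕ
xorF zero    a b = 0
xorF (suc f) a b =
  (if (a % 2) ≡ᵇ (b % 2) then 0 else 1) + 2 * xorF f (a / 2) (b / 2)

infixl 5 _⊕_
_⊕_ : ℕ → ℕ → ℕ
a ⊕ b = xorF (a + b) a b

-- Carry-less product a ⋆ b (recursion on the bits of b; fuel = b).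
clmulF : ℕ → ℕ → ℕ → ℕ
clmulF zero    a b = 0
clmulF (suc f) a b =
  (if (b % 2) ≡ᵇ 1 then a else 0) ⊕ (2 * clmulF f a (b / 2))

infixl 7 _⋆_
_⋆_ : ℕ → ℕ → ℕ
a ⋆ b = clmulF b a b

-- degree(b) = index of the most significant set bit (for b ≠ 0).
degree : ℕ → ℕ
degree b = ⌊log₂ b ⌋

-- Each step clears the leading bit of a, so fuel = a suffices.
-- For b = 0 the result is an arbitrary junk value (0 , a); it is never used.
cldivmodF : ℕ → ℕ → ℕ → ℕ × ℕ
cldivmodF zero    a b = (0 , a)
cldivmodF (suc f) a zero = (0 , a)
cldivmodF (suc f) zero b = (0 , 0)
cldivmodF (suc f) a@(suc _) b@(suc _) =
  if degree a <ᵇ degree b then (0 , a)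
  else (let s = degree a ∸ degree b
            r = cldivmodF f (a ⊕ (b * 2 ^ s)) b
        in (proj₁ r ⊕ 2 ^ s , proj₂ r))

infixl 7 _÷_ _mod_
_÷_ : ℕ → ℕ → ℕ
a ÷ b = proj₁ (cldivmodF a a b)

_mod_ : ℕ → ℕ → ℕ
a mod b = proj₂ (cldivmodF a a b)

-- Read naturals as polynomials over GF(2) (⊕ is addition, ⋆ multiplication); then 2 ^ k ≡ r
-- modulo p = 2 ^ k ⊕ r.  So x = (x ÷ 2 ^ k) ⋆ 2 ^ k ⊕ x mod 2 ^ k is congruent to z ⊕ x mod 2 ^ k;
-- splitting z at bit k and reducing its high part gives the right-hand side, every term of which lies
-- below 2 ^ k = 2 ^ degree p, so uniqueness of the carry-less remainder identifies it with x mod p.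
-- The algebra of ⊕ and ⋆ is proved digit by digit: both commute with halving, which makes (ℕ, ⊕, 0)
-- an abelian group of exponent 2 over which ⋆ distributes.
module Submission where

open import Defs
open import Data.Nat using (ℕ; _<_; _^_)
open import Relation.Binary.PropositionalEquality using (_≡_)

open import Algebra.Bundles using (AbelianGroup)
open import Algebra.Structures using (IsAbelianGroup)
open import Data.Bool using (true; false; if_then_else_; T)
open import Data.Nat
  using (zero; suc; _+_; _*_; _∸_; _≤_; _≡ᵇ_; _<ᵇ_; z≤n; s≤s; z<s; ⌊_/2⌋)
open import Data.Nat.DivMod
  using (_/_; _%_; m≡m%n+[m/n]*n; [m+kn]%n≡m%n; m<n⇒m%n≡m; m<n⇒m/n≡0; m%n<n;
         +-distrib-/-∣ʳ; m*n/n≡m; m/n<m; m<n*o⇒m/o<n; m≥n⇒m/n>0; m/n≡1+[m∸n]/n)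
open import Data.Nat.Divisibility using (divides)
open import Data.Nat.Induction using (<-rec)
open import Data.Nat.Logarithm using (⌊log₂_⌋; ⌊log₂⌋-mono-≤; ⌊log₂⌊n/2⌋⌋≡⌊log₂n⌋∸1; ⌊log₂[2^n]⌋≡n)
open import Data.Nat.Properties
open import Data.Product using (_×_; _,_; proj₁; proj₂)
open import Data.Sum using (_⊎_; inj₁; inj₂)
open import Relation.Nullary using (contradiction)
open import Function using (id)
open import Relation.Binary.PropositionalEquality
  using (refl; sym; trans; cong; cong₂; subst; isEquivalence; module ≡-Reasoning)

-- Binary digits

m≡m%2+2*[m/2] : ∀ m → m ≡ m % 2 + 2 * (m / 2)
m≡m%2+2*[m/2] m = trans (m≡m%n+[m/n]*n m 2) (cong (m % 2 +_) (*-comm (m / 2) 2))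

m%2≤1 : ∀ m → m % 2 ≤ 1
m%2≤1 m = ≤-pred (m%n<n m 2)

[b+2*m]%2≡b : ∀ {b} m → b ≤ 1 → (b + 2 * m) % 2 ≡ b
[b+2*m]%2≡b {b} m b≤1 = begin
  (b + 2 * m) % 2 ≡⟨ cong (λ t → (b + t) % 2) (*-comm 2 m) ⟩
  (b + m * 2) % 2 ≡⟨ [m+kn]%n≡m%n b m 2 ⟩
  b % 2           ≡⟨ m<n⇒m%n≡m (s≤s b≤1) ⟩
  b               ∎
  where open ≡-Reasoning

[b+2*m]/2≡m : ∀ {b} m → b ≤ 1 → (b + 2 * m) / 2 ≡ m
[b+2*m]/2≡m {b} m b≤1 = begin
  (b + 2 * m) / 2       ≡⟨ +-distrib-/-∣ʳ b (divides m (*-comm 2 m)) ⟩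
  b / 2 + (2 * m) / 2   ≡⟨ cong₂ _+_ (m<n⇒m/n≡0 (s≤s b≤1)) (trans (cong (_/ 2) (*-comm 2 m)) (m*n/n≡m m 2)) ⟩
  m                     ∎
  where open ≡-Reasoning

≡-by-%2-/2 : ∀ {m n} → m % 2 ≡ n % 2 → m / 2 ≡ n / 2 → m ≡ n
≡-by-%2-/2 {m} {n} p q =
  trans (m≡m%2+2*[m/2] m) (trans (cong₂ (λ b h → b + 2 * h) p q) (sym (m≡m%2+2*[m/2] n)))

IsBit : ℕ → Set
IsBit b = b ≡ 0 ⊎ b ≡ 1

m%2-isBit : ∀ m → IsBit (m % 2)
m%2-isBit m with m % 2 | m%2≤1 m
... | 0 | _       = inj₁ refl
... | 1 | _       = inj₂ refl
... | suc (suc _) | s≤s ()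

m/2≤n : ∀ {m n} → m ≤ suc n → m / 2 ≤ n
m/2≤n {zero}  _         = z≤n
m/2≤n {suc m} (s≤s m≤n) = ≤-trans (≤-pred (m/n<m (suc m) 2 (s≤s (s≤s z≤n)))) m≤n

bitwise-induction : ∀ {ℓ} (P : ℕ → Set ℓ) → P 0 → (∀ n → 0 < n → P (n / 2) → P n) → ∀ n → P n
bitwise-induction P P0 step = <-rec P go
  where
  go : ∀ n → (∀ {m} → m < n → P m) → P n
  go zero    _   = P0
  go (suc n) rec = step (suc n) z<s (rec (m/n<m (suc n) 2 (s≤s (s≤s z≤n))))

m<2*n⇒m/2<n : ∀ {m n} → m < 2 * n → m / 2 < n
m<2*n⇒m/2<n {m} {n} lt = m<n*o⇒m/o<n (subst (m <_) (*-comm 2 n) lt)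

m/2<n⇒m<2*n : ∀ {m n} → m / 2 < n → m < 2 * n
m/2<n⇒m<2*n {m} {n} lt = begin-strict
  m                   ≡⟨ m≡m%2+2*[m/2] m ⟩
  m % 2 + 2 * (m / 2) <⟨ +-monoˡ-< (2 * (m / 2)) (s≤s (m%2≤1 m)) ⟩
  2 + 2 * (m / 2)     ≡⟨ sym (*-suc 2 (m / 2)) ⟩
  2 * suc (m / 2)     ≤⟨ *-monoʳ-≤ 2 lt ⟩
  2 * n               ∎
  where open ≤-Reasoning

2*n≤m⇒n≤m/2 : ∀ {m n} → 2 * n ≤ m → n ≤ m / 2
2*n≤m⇒n≤m/2 le = ≮⇒≥ (λ lt → <⇒≱ (m/2<n⇒m<2*n lt) le)

n≤m/2⇒2*n≤m : ∀ {m n} → n ≤ m / 2 → 2 * n ≤ m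
n≤m/2⇒2*n≤m le = ≮⇒≥ (λ lt → <⇒≱ (m<2*n⇒m/2<n lt) le)

-- Exclusive or

xorBit : ℕ → ℕ → ℕ
xorBit i j = if i ≡ᵇ j then 0 else 1

xorBit≤1 : ∀ i j → xorBit i j ≤ 1
xorBit≤1 i j with i ≡ᵇ j
... | true  = z≤n
... | false = ≤-refl

xorBit-identityʳ : ∀ {i} → IsBit i → xorBit i 0 ≡ i
xorBit-identityʳ (inj₁ refl) = refl
xorBit-identityʳ (inj₂ refl) = refl

xorBit-identityˡ : ∀ {i} → IsBit i → xorBit 0 i ≡ i
xorBit-identityˡ (inj₁ refl) = refl
xorBit-identityˡ (inj₂ refl) = refl

xorBit-self : ∀ {i} → IsBit i → xorBit i i ≡ 0
xorBit-self (inj₁ refl) = refl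
xorBit-self (inj₂ refl) = refl

xorBit-comm : ∀ {i j} → IsBit i → IsBit j → xorBit i j ≡ xorBit j i
xorBit-comm (inj₁ refl) (inj₁ refl) = refl
xorBit-comm (inj₁ refl) (inj₂ refl) = refl
xorBit-comm (inj₂ refl) (inj₁ refl) = refl
xorBit-comm (inj₂ refl) (inj₂ refl) = refl

xorBit-assoc : ∀ {i j k} → IsBit i → IsBit j → IsBit k → xorBit (xorBit i j) k ≡ xorBit i (xorBit j k)
xorBit-assoc (inj₁ refl) (inj₁ refl) (inj₁ refl) = refl
xorBit-assoc (inj₁ refl) (inj₁ refl) (inj₂ refl) = refl
xorBit-assoc (inj₁ refl) (inj₂ refl) (inj₁ refl) = refl
xorBit-assoc (inj₁ refl) (inj₂ refl) (inj₂ refl) = refl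
xorBit-assoc (inj₂ refl) (inj₁ refl) (inj₁ refl) = refl
xorBit-assoc (inj₂ refl) (inj₁ refl) (inj₂ refl) = refl
xorBit-assoc (inj₂ refl) (inj₂ refl) (inj₁ refl) = refl
xorBit-assoc (inj₂ refl) (inj₂ refl) (inj₂ refl) = refl

xorF-zero : ∀ f → xorF f 0 0 ≡ 0
xorF-zero zero    = refl
xorF-zero (suc f) = cong (2 *_) (xorF-zero f)

xorF-fuel : ∀ {f g a b} → a ≤ f → b ≤ f → a ≤ g → b ≤ g → xorF f a b ≡ xorF g a b
xorF-fuel {zero}  {g}    z≤n z≤n _   _   = sym (xorF-zero g)
xorF-fuel {suc f} {zero} _   _   z≤n z≤n = xorF-zero (suc f)
xorF-fuel {suc f} {suc g} {a} {b} af bf ag bg =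
  cong (λ t → xorBit (a % 2) (b % 2) + 2 * t) (xorF-fuel (m/2≤n af) (m/2≤n bf) (m/2≤n ag) (m/2≤n bg))

xorF-adequate : ∀ {f a b} → a ≤ f → b ≤ f → xorF f a b ≡ a ⊕ b
xorF-adequate {a = a} {b} af bf = xorF-fuel af bf (m≤m+n a b) (m≤n+m b a)

⊕-unfold : ∀ a b → a ⊕ b ≡ xorBit (a % 2) (b % 2) + 2 * (a / 2 ⊕ b / 2)
⊕-unfold zero    zero    = refl
⊕-unfold zero    (suc b) =
  cong (λ t → xorBit 0 (suc b % 2) + 2 * t) (xorF-adequate {b} z≤n (m/2≤n ≤-refl))
⊕-unfold (suc a) b       =
  cong (λ t → xorBit (suc a % 2) (b % 2) + 2 * t)
       (xorF-adequate {a + b} (m/2≤n (s≤s (m≤m+n a b))) (m/2≤n (m≤n+m b (suc a))))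

⊕-%2 : ∀ a b → (a ⊕ b) % 2 ≡ xorBit (a % 2) (b % 2)
⊕-%2 a b = trans (cong (_% 2) (⊕-unfold a b)) ([b+2*m]%2≡b (a / 2 ⊕ b / 2) (xorBit≤1 (a % 2) (b % 2)))

⊕-/2 : ∀ a b → (a ⊕ b) / 2 ≡ a / 2 ⊕ b / 2
⊕-/2 a b = trans (cong (_/ 2) (⊕-unfold a b)) ([b+2*m]/2≡m (a / 2 ⊕ b / 2) (xorBit≤1 (a % 2) (b % 2)))

⊕-identityʳ : ∀ a → a ⊕ 0 ≡ a
⊕-identityʳ = bitwise-induction _ refl λ a _ ih →
  ≡-by-%2-/2 (trans (⊕-%2 a 0) (xorBit-identityʳ (m%2-isBit a))) (trans (⊕-/2 a 0) ih)

⊕-identityˡ : ∀ a → 0 ⊕ a ≡ a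
⊕-identityˡ = bitwise-induction _ refl λ a _ ih →
  ≡-by-%2-/2 (trans (⊕-%2 0 a) (xorBit-identityˡ (m%2-isBit a))) (trans (⊕-/2 0 a) ih)

⊕-self : ∀ a → a ⊕ a ≡ 0
⊕-self = bitwise-induction _ refl λ a _ ih →
  ≡-by-%2-/2 {n = 0} (trans (⊕-%2 a a) (xorBit-self (m%2-isBit a))) (trans (⊕-/2 a a) ih)

⊕-comm : ∀ a b → a ⊕ b ≡ b ⊕ a
⊕-comm = bitwise-induction _ (λ b → trans (⊕-identityˡ b) (sym (⊕-identityʳ b))) λ a _ ih b →
  ≡-by-%2-/2
    (trans (⊕-%2 a b) (trans (xorBit-comm (m%2-isBit a) (m%2-isBit b)) (sym (⊕-%2 b a))))
    (trans (⊕-/2 a b) (trans (ih (b / 2)) (sym (⊕-/2 b a))))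

⊕-assoc : ∀ a b c → (a ⊕ b) ⊕ c ≡ a ⊕ (b ⊕ c)
⊕-assoc = bitwise-induction _ base λ a _ ih b c → ≡-by-%2-/2 (parities a b c) (halves a b c ih)
  where
  base : ∀ b c → (0 ⊕ b) ⊕ c ≡ 0 ⊕ (b ⊕ c)
  base b c = trans (cong (_⊕ c) (⊕-identityˡ b)) (sym (⊕-identityˡ (b ⊕ c)))
  parities : ∀ a b c → ((a ⊕ b) ⊕ c) % 2 ≡ (a ⊕ (b ⊕ c)) % 2
  parities a b c = begin
    ((a ⊕ b) ⊕ c) % 2                       ≡⟨ trans (⊕-%2 (a ⊕ b) c) (cong (λ t → xorBit t (c % 2)) (⊕-%2 a b)) ⟩
    xorBit (xorBit (a % 2) (b % 2)) (c % 2) ≡⟨ xorBit-assoc (m%2-isBit a) (m%2-isBit b) (m%2-isBit c) ⟩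
    xorBit (a % 2) (xorBit (b % 2) (c % 2)) ≡⟨ sym (trans (⊕-%2 a (b ⊕ c)) (cong (xorBit (a % 2)) (⊕-%2 b c))) ⟩
    (a ⊕ (b ⊕ c)) % 2                       ∎
    where open ≡-Reasoning
  halves : ∀ a b c → (∀ b c → (a / 2 ⊕ b) ⊕ c ≡ a / 2 ⊕ (b ⊕ c)) → ((a ⊕ b) ⊕ c) / 2 ≡ (a ⊕ (b ⊕ c)) / 2
  halves a b c ih = begin
    ((a ⊕ b) ⊕ c) / 2             ≡⟨ trans (⊕-/2 (a ⊕ b) c) (cong (_⊕ c / 2) (⊕-/2 a b)) ⟩
    (a / 2 ⊕ b / 2) ⊕ c / 2       ≡⟨ ih (b / 2) (c / 2) ⟩
    a / 2 ⊕ (b / 2 ⊕ c / 2)       ≡⟨ sym (trans (⊕-/2 a (b ⊕ c)) (cong (a / 2 ⊕_) (⊕-/2 b c))) ⟩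
    (a ⊕ (b ⊕ c)) / 2             ∎
    where open ≡-Reasoning

⊕-isAbelianGroup : IsAbelianGroup _≡_ _⊕_ 0 id
⊕-isAbelianGroup = record
  { isGroup = record
    { isMonoid = record
      { isSemigroup = record
        { isMagma = record { isEquivalence = isEquivalence ; ∙-cong = cong₂ _⊕_ }
        ; assoc   = ⊕-assoc
        }
      ; identity = ⊕-identityˡ , ⊕-identityʳ
      }
    ; inverse = ⊕-self , ⊕-self
    ; ⁻¹-cong = id
    }
  ; comm = ⊕-comm
  }

⊕-abelianGroup : AbelianGroup _ _
⊕-abelianGroup = record { isAbelianGroup = ⊕-isAbelianGroup }

open import Algebra.Properties.Group (AbelianGroup.group ⊕-abelianGroup)
  using (inverseˡ-unique; //-rightDividesʳ)
open import Algebra.Properties.CommutativeSemigroup (AbelianGroup.commutativeSemigroup ⊕-abelianGroup)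
  using (interchange; xy∙z≈xz∙y)

2*-distrib-⊕ : ∀ m n → 2 * m ⊕ 2 * n ≡ 2 * (m ⊕ n)
2*-distrib-⊕ m n = ≡-by-%2-/2
  (trans (⊕-%2 (2 * m) (2 * n))
    (trans (cong₂ xorBit ([b+2*m]%2≡b m z≤n) ([b+2*m]%2≡b n z≤n)) (sym ([b+2*m]%2≡b (m ⊕ n) z≤n))))
  (trans (⊕-/2 (2 * m) (2 * n))
    (trans (cong₂ _⊕_ ([b+2*m]/2≡m m z≤n) ([b+2*m]/2≡m n z≤n)) (sym ([b+2*m]/2≡m (m ⊕ n) z≤n))))

b⊕2*m≡b+2*m : ∀ {b} m → b ≤ 1 → b ⊕ 2 * m ≡ b + 2 * m
b⊕2*m≡b+2*m {b} m b≤1 = ≡-by-%2-/2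
  (begin
    (b ⊕ 2 * m) % 2           ≡⟨ trans (⊕-%2 b (2 * m)) (cong (xorBit (b % 2)) ([b+2*m]%2≡b m z≤n)) ⟩
    xorBit (b % 2) 0          ≡⟨ xorBit-identityʳ (m%2-isBit b) ⟩
    b % 2                     ≡⟨ m<n⇒m%n≡m (s≤s b≤1) ⟩
    b                         ≡⟨ sym ([b+2*m]%2≡b m b≤1) ⟩
    (b + 2 * m) % 2           ∎)
  (begin
    (b ⊕ 2 * m) / 2           ≡⟨ trans (⊕-/2 b (2 * m)) (cong₂ _⊕_ (m<n⇒m/n≡0 (s≤s b≤1)) ([b+2*m]/2≡m m z≤n)) ⟩
    0 ⊕ m                     ≡⟨ ⊕-identityˡ m ⟩
    m                         ≡⟨ sym ([b+2*m]/2≡m m b≤1) ⟩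
    (b + 2 * m) / 2           ∎)
  where open ≡-Reasoning

m≡m%2⊕2*[m/2] : ∀ m → m ≡ m % 2 ⊕ 2 * (m / 2)
m≡m%2⊕2*[m/2] m = trans (m≡m%2+2*[m/2] m) (sym (b⊕2*m≡b+2*m (m / 2) (m%2≤1 m)))

⊕-interchange-2* : ∀ a b m n → (a ⊕ 2 * m) ⊕ (b ⊕ 2 * n) ≡ (a ⊕ b) ⊕ 2 * (m ⊕ n)
⊕-interchange-2* a b m n = trans (interchange a (2 * m) b (2 * n)) (cong ((a ⊕ b) ⊕_) (2*-distrib-⊕ m n))

⊕-<-2^ : ∀ k {a b} → a < 2 ^ k → b < 2 ^ k → a ⊕ b < 2 ^ k
⊕-<-2^ zero    (s≤s z≤n) (s≤s z≤n) = s≤s z≤n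
⊕-<-2^ (suc k) {a} {b} a< b< = m/2<n⇒m<2*n
  (subst (_< 2 ^ k) (sym (⊕-/2 a b)) (⊕-<-2^ k (m<2*n⇒m/2<n a<) (m<2*n⇒m/2<n b<)))

⊕-≥-2^ : ∀ k {a b} → a < 2 ^ k → 2 ^ k ≤ b → 2 ^ k ≤ a ⊕ b
⊕-≥-2^ zero    {b = b} (s≤s z≤n) 1≤b = subst (1 ≤_) (sym (⊕-identityˡ b)) 1≤b
⊕-≥-2^ (suc k) {a} {b} a< ≤b = n≤m/2⇒2*n≤m
  (subst (2 ^ k ≤_) (sym (⊕-/2 a b)) (⊕-≥-2^ k (m<2*n⇒m/2<n a<) (2*n≤m⇒n≤m/2 ≤b)))

⊕-<-2^-cancel-leading : ∀ k {a b} → 2 ^ k ≤ a → a < 2 ^ suc k → 2 ^ k ≤ b → b < 2 ^ suc k → a ⊕ b < 2 ^ k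
⊕-<-2^-cancel-leading zero (s≤s z≤n) (s≤s (s≤s z≤n)) (s≤s z≤n) (s≤s (s≤s z≤n)) = s≤s z≤n
⊕-<-2^-cancel-leading (suc k) {a} {b} ≤a a< ≤b b< = m/2<n⇒m<2*n
  (subst (_< 2 ^ k) (sym (⊕-/2 a b))
    (⊕-<-2^-cancel-leading k (2*n≤m⇒n≤m/2 ≤a) (m<2*n⇒m/2<n a<) (2*n≤m⇒n≤m/2 ≤b) (m<2*n⇒m/2<n b<)))

-- Degree

⌊n/2⌋≡n/2 : ∀ n → ⌊ n /2⌋ ≡ n / 2
⌊n/2⌋≡n/2 zero          = refl
⌊n/2⌋≡n/2 (suc zero)    = refl
⌊n/2⌋≡n/2 (suc (suc n)) = trans (cong suc (⌊n/2⌋≡n/2 n)) (sym (m/n≡1+[m∸n]/n {suc (suc n)} {2} (s≤s (s≤s z≤n))))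

degree≡1+degree[n/2] : ∀ {n} → 2 ≤ n → degree n ≡ suc (degree (n / 2))
degree≡1+degree[n/2] {n} 2≤n = begin
  degree n                 ≡⟨ sym (m+[n∸m]≡n (⌊log₂⌋-mono-≤ 2≤n)) ⟩
  suc (degree n ∸ 1)       ≡⟨ cong suc (sym (⌊log₂⌊n/2⌋⌋≡⌊log₂n⌋∸1 n)) ⟩
  suc ⌊log₂ ⌊ n /2⌋ ⌋      ≡⟨ cong (λ m → suc ⌊log₂ m ⌋) (⌊n/2⌋≡n/2 n) ⟩
  suc (degree (n / 2))     ∎
  where open ≡-Reasoning

DegreeBounds : ℕ → Set
DegreeBounds n = 2 ^ degree n ≤ n × n < 2 ^ suc (degree n)

degree-bounds : ∀ n → 0 < n → DegreeBounds n
degree-bounds = bitwise-induction _ (λ ()) step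
  where
  step≥2 : ∀ {n} → 2 ≤ n → DegreeBounds (n / 2) → DegreeBounds n
  step≥2 {n} 2≤n (lo , hi) =
    subst (λ d → 2 ^ d ≤ n × n < 2 ^ suc d) (sym (degree≡1+degree[n/2] 2≤n)) (n≤m/2⇒2*n≤m lo , m/2<n⇒m<2*n hi)
  step : ∀ n → 0 < n → (0 < n / 2 → DegreeBounds (n / 2)) → 0 < n → DegreeBounds n
  step (suc zero)      _ _  _ = ≤-refl , s≤s (s≤s z≤n)
  step n@(suc (suc m)) _ ih _ = step≥2 2≤n (ih (m≥n⇒m/n>0 {n} {2} 2≤n))
    where
    2≤n : 2 ≤ n
    2≤n = s≤s (s≤s z≤n)

2^-cancel-< : ∀ {m n} → 2 ^ m < 2 ^ n → m < n
2^-cancel-< lt = ≰⇒> (λ n≤m → <⇒≱ lt (^-monoʳ-≤ 2 n≤m))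

degree-unique : ∀ {k n} → 2 ^ k ≤ n → n < 2 ^ suc k → degree n ≡ k
degree-unique {k} {n} lo hi with degree-bounds n (≤-trans (m^n>0 2 k) lo)
... | lo′ , hi′ = ≤-antisym (≤-pred (2^-cancel-< (≤-<-trans lo′ hi))) (≤-pred (2^-cancel-< (≤-<-trans lo hi′)))

-- Carry-less product

select : ℕ → ℕ → ℕ
select c a = if c ≡ᵇ 1 then a else 0

select-zero : ∀ c → select c 0 ≡ 0
select-zero c with c ≡ᵇ 1
... | true  = refl
... | false = refl

select-2* : ∀ c a → select c (2 * a) ≡ 2 * select c a
select-2* c a with c ≡ᵇ 1
... | true  = refl
... | false = refl

select-⊕ : ∀ c a b → select c (a ⊕ b) ≡ select c a ⊕ select c b
select-⊕ c a b with c ≡ᵇ 1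
... | true  = refl
... | false = refl

select-one : ∀ {c} → IsBit c → select c 1 ≡ c
select-one (inj₁ refl) = refl
select-one (inj₂ refl) = refl

select-xorBit : ∀ {i j} a → IsBit i → IsBit j → select (xorBit i j) a ≡ select i a ⊕ select j a
select-xorBit a (inj₁ refl) (inj₁ refl) = refl
select-xorBit a (inj₁ refl) (inj₂ refl) = sym (⊕-identityˡ a)
select-xorBit a (inj₂ refl) (inj₁ refl) = sym (⊕-identityʳ a)
select-xorBit a (inj₂ refl) (inj₂ refl) = sym (⊕-self a)

clmulF-zero : ∀ f a → clmulF f a 0 ≡ 0
clmulF-zero zero    a = refl
clmulF-zero (suc f) a = cong (λ t → 0 ⊕ 2 * t) (clmulF-zero f a)

clmulF-fuel : ∀ {f g} a {b} → b ≤ f → b ≤ g → clmulF f a b ≡ clmulF g a b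
clmulF-fuel {zero}  {g}     a z≤n _   = sym (clmulF-zero g a)
clmulF-fuel {suc f} {zero}  a _   z≤n = clmulF-zero (suc f) a
clmulF-fuel {suc f} {suc g} a {b} bf bg =
  cong (λ t → select (b % 2) a ⊕ 2 * t) (clmulF-fuel a (m/2≤n bf) (m/2≤n bg))

⋆-unfold : ∀ a b → a ⋆ b ≡ select (b % 2) a ⊕ 2 * (a ⋆ (b / 2))
⋆-unfold a zero    = refl
⋆-unfold a (suc b) = cong (λ t → select (suc b % 2) a ⊕ 2 * t) (clmulF-fuel {b} a (m/2≤n ≤-refl) ≤-refl)

⋆-zeroˡ : ∀ b → 0 ⋆ b ≡ 0
⋆-zeroˡ = bitwise-induction _ refl λ b _ ih →
  trans (⋆-unfold 0 b) (cong₂ (λ s t → s ⊕ 2 * t) (select-zero (b % 2)) ih)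

⋆-identityˡ : ∀ b → 1 ⋆ b ≡ b
⋆-identityˡ = bitwise-induction _ refl λ b _ ih → begin
  1 ⋆ b                         ≡⟨ ⋆-unfold 1 b ⟩
  select (b % 2) 1 ⊕ 2 * (1 ⋆ (b / 2)) ≡⟨ cong₂ (λ s t → s ⊕ 2 * t) (select-one (m%2-isBit b)) ih ⟩
  b % 2 ⊕ 2 * (b / 2)           ≡⟨ sym (m≡m%2⊕2*[m/2] b) ⟩
  b                             ∎
  where open ≡-Reasoning

2*-⋆ : ∀ a b → (2 * a) ⋆ b ≡ 2 * (a ⋆ b)
2*-⋆ a = bitwise-induction _ refl λ b _ ih → begin
  (2 * a) ⋆ b                                       ≡⟨ ⋆-unfold (2 * a) b ⟩
  select (b % 2) (2 * a) ⊕ 2 * ((2 * a) ⋆ (b / 2))  ≡⟨ cong₂ (λ s t → s ⊕ 2 * t) (select-2* (b % 2) a) ih ⟩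
  2 * select (b % 2) a ⊕ 2 * (2 * (a ⋆ (b / 2)))    ≡⟨ 2*-distrib-⊕ (select (b % 2) a) (2 * (a ⋆ (b / 2))) ⟩
  2 * (select (b % 2) a ⊕ 2 * (a ⋆ (b / 2)))        ≡⟨ cong (2 *_) (sym (⋆-unfold a b)) ⟩
  2 * (a ⋆ b)                                       ∎
  where open ≡-Reasoning

⋆-distribʳ-⊕ : ∀ a b c → (a ⊕ b) ⋆ c ≡ a ⋆ c ⊕ b ⋆ c
⋆-distribʳ-⊕ a b = bitwise-induction _ refl λ c _ ih → begin
  (a ⊕ b) ⋆ c
    ≡⟨ ⋆-unfold (a ⊕ b) c ⟩
  select (c % 2) (a ⊕ b) ⊕ 2 * ((a ⊕ b) ⋆ (c / 2))
    ≡⟨ cong₂ (λ s t → s ⊕ 2 * t) (select-⊕ (c % 2) a b) ih ⟩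
  (select (c % 2) a ⊕ select (c % 2) b) ⊕ 2 * (a ⋆ (c / 2) ⊕ b ⋆ (c / 2))
    ≡⟨ sym (⊕-interchange-2* (select (c % 2) a) (select (c % 2) b) (a ⋆ (c / 2)) (b ⋆ (c / 2))) ⟩
  (select (c % 2) a ⊕ 2 * (a ⋆ (c / 2))) ⊕ (select (c % 2) b ⊕ 2 * (b ⋆ (c / 2)))
    ≡⟨ sym (cong₂ _⊕_ (⋆-unfold a c) (⋆-unfold b c)) ⟩
  a ⋆ c ⊕ b ⋆ c ∎
  where open ≡-Reasoning

⋆-distribˡ-⊕ : ∀ a b c → a ⋆ (b ⊕ c) ≡ a ⋆ b ⊕ a ⋆ c
⋆-distribˡ-⊕ a = bitwise-induction _ base λ b _ ih c → begin
  a ⋆ (b ⊕ c)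
    ≡⟨ ⋆-unfold a (b ⊕ c) ⟩
  select ((b ⊕ c) % 2) a ⊕ 2 * (a ⋆ ((b ⊕ c) / 2))
    ≡⟨ cong₂ (λ s t → select s a ⊕ 2 * (a ⋆ t)) (⊕-%2 b c) (⊕-/2 b c) ⟩
  select (xorBit (b % 2) (c % 2)) a ⊕ 2 * (a ⋆ (b / 2 ⊕ c / 2))
    ≡⟨ cong₂ (λ s t → s ⊕ 2 * t) (select-xorBit a (m%2-isBit b) (m%2-isBit c)) (ih (c / 2)) ⟩
  (select (b % 2) a ⊕ select (c % 2) a) ⊕ 2 * (a ⋆ (b / 2) ⊕ a ⋆ (c / 2))
    ≡⟨ sym (⊕-interchange-2* (select (b % 2) a) (select (c % 2) a) (a ⋆ (b / 2)) (a ⋆ (c / 2))) ⟩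
  (select (b % 2) a ⊕ 2 * (a ⋆ (b / 2))) ⊕ (select (c % 2) a ⊕ 2 * (a ⋆ (c / 2)))
    ≡⟨ sym (cong₂ _⊕_ (⋆-unfold a b) (⋆-unfold a c)) ⟩
  a ⋆ b ⊕ a ⋆ c ∎
  where
  open ≡-Reasoning
  base : ∀ c → a ⋆ (0 ⊕ c) ≡ a ⋆ 0 ⊕ a ⋆ c
  base c = trans (cong (a ⋆_) (⊕-identityˡ c)) (sym (⊕-identityˡ (a ⋆ c)))

2^-⋆ : ∀ s b → 2 ^ s ⋆ b ≡ b * 2 ^ s
2^-⋆ zero    b = trans (⋆-identityˡ b) (sym (*-identityʳ b))
2^-⋆ (suc s) b = begin
  (2 * 2 ^ s) ⋆ b   ≡⟨ 2*-⋆ (2 ^ s) b ⟩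
  2 * (2 ^ s ⋆ b)   ≡⟨ cong (2 *_) (2^-⋆ s b) ⟩
  2 * (b * 2 ^ s)   ≡⟨ x∙yz≈y∙xz 2 b (2 ^ s) ⟩
  b * (2 * 2 ^ s)   ∎
  where
  open ≡-Reasoning
  open import Algebra.Properties.CommutativeSemigroup *-commutativeSemigroup using (x∙yz≈y∙xz)

⋆-unfoldˡ : ∀ a b → a ⋆ b ≡ (a % 2) ⋆ b ⊕ 2 * ((a / 2) ⋆ b)
⋆-unfoldˡ a b = begin
  a ⋆ b                                 ≡⟨ cong (_⋆ b) (m≡m%2⊕2*[m/2] a) ⟩
  (a % 2 ⊕ 2 * (a / 2)) ⋆ b             ≡⟨ ⋆-distribʳ-⊕ (a % 2) (2 * (a / 2)) b ⟩
  (a % 2) ⋆ b ⊕ (2 * (a / 2)) ⋆ b       ≡⟨ cong ((a % 2) ⋆ b ⊕_) (2*-⋆ (a / 2) b) ⟩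
  (a % 2) ⋆ b ⊕ 2 * ((a / 2) ⋆ b)       ∎
  where open ≡-Reasoning

2^degree≤⋆ : ∀ {b} → 0 < b → ∀ a → 0 < a → 2 ^ degree b ≤ a ⋆ b
2^degree≤⋆ {b} 0<b = bitwise-induction _ (λ ()) step
  where
  k : ℕ
  k = degree b
  bounds : DegreeBounds b
  bounds = degree-bounds b 0<b
  digit⋆≤ : ∀ a → (a % 2) ⋆ b ≤ b
  digit⋆≤ a with a % 2 | m%2-isBit a
  ... | .0 | inj₁ refl = ≤-trans (≤-reflexive (⋆-zeroˡ b)) z≤n
  ... | .1 | inj₂ refl = ≤-reflexive (⋆-identityˡ b)
  step : ∀ a → 0 < a → (0 < a / 2 → 2 ^ k ≤ (a / 2) ⋆ b) → 0 < a → 2 ^ k ≤ a ⋆ b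
  step (suc zero) _ _ _ = subst (2 ^ k ≤_) (sym (⋆-identityˡ b)) (proj₁ bounds)
  step a@(suc (suc _)) _ ih _ = ≤-trans (^-monoʳ-≤ 2 (n≤1+n k))
    (subst (2 ^ suc k ≤_) (sym (⋆-unfoldˡ a b))
      (⊕-≥-2^ (suc k) (≤-<-trans (digit⋆≤ a) (proj₂ bounds))
        (*-monoʳ-≤ 2 (ih (m≥n⇒m/n>0 {a} {2} (s≤s (s≤s z≤n)))))))

⋆-<-2^degree⇒≡0 : ∀ {a b} → 0 < b → a ⋆ b < 2 ^ degree b → a ⋆ b ≡ 0
⋆-<-2^degree⇒≡0 {zero}  {b} _   _  = ⋆-zeroˡ b
⋆-<-2^degree⇒≡0 {suc a} {b} 0<b lt = contradiction (2^degree≤⋆ 0<b (suc a) z<s) (<⇒≱ lt)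

-- Carry-less division

-- β < 2 ^ degree b is the condition "β = 0 or degree β < degree b".
IsDivMod : ℕ → ℕ → ℕ × ℕ → Set
IsDivMod a b (α , β) = a ≡ α ⋆ b ⊕ β × β < 2 ^ degree b

*2^-bounds : ∀ {k b} → 2 ^ k ≤ b → b < 2 ^ suc k → ∀ s → 2 ^ (k + s) ≤ b * 2 ^ s × b * 2 ^ s < 2 ^ suc (k + s)
*2^-bounds {k} lo hi s =
  ≤-trans (≤-reflexive (^-distribˡ-+-* 2 k s)) (*-monoˡ-≤ (2 ^ s) lo) ,
  <-≤-trans (*-monoˡ-< (2 ^ s) {{m^n≢0 2 s}} hi) (≤-reflexive (sym (^-distribˡ-+-* 2 (suc k) s)))

⊕-shift-<-2^degree : ∀ {a b} → 0 < a → 0 < b → degree b ≤ degree a →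
                     a ⊕ b * 2 ^ (degree a ∸ degree b) < 2 ^ degree a
⊕-shift-<-2^degree {a} {b} 0<a 0<b le with degree-bounds a 0<a | degree-bounds b 0<b
... | loa , hia | lob , hib =
  ⊕-<-2^-cancel-leading (degree a) loa hia (subst (λ d → 2 ^ d ≤ shifted) k≡ lo) (subst (λ d → shifted < 2 ^ suc d) k≡ hi)
  where
  s shifted : ℕ
  s = degree a ∸ degree b
  shifted = b * 2 ^ s
  k≡ : degree b + s ≡ degree a
  k≡ = m+[n∸m]≡n le
  lo : 2 ^ (degree b + s) ≤ shifted
  lo = proj₁ (*2^-bounds {degree b} lob hib s)
  hi : shifted < 2 ^ suc (degree b + s)
  hi = proj₂ (*2^-bounds {degree b} lob hib s)

isDivMod-shift : ∀ {a b q r} s → IsDivMod (a ⊕ b * 2 ^ s) b (q , r) → IsDivMod a b (q ⊕ 2 ^ s , r)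
isDivMod-shift {a} {b} {q} {r} s (e , r<) = (begin
  a                               ≡⟨ sym (//-rightDividesʳ (b * 2 ^ s) a) ⟩
  (a ⊕ b * 2 ^ s) ⊕ b * 2 ^ s     ≡⟨ cong (_⊕ b * 2 ^ s) e ⟩
  (q ⋆ b ⊕ r) ⊕ b * 2 ^ s         ≡⟨ xy∙z≈xz∙y (q ⋆ b) r (b * 2 ^ s) ⟩
  (q ⋆ b ⊕ b * 2 ^ s) ⊕ r         ≡⟨ cong (λ t → (q ⋆ b ⊕ t) ⊕ r) (sym (2^-⋆ s b)) ⟩
  (q ⋆ b ⊕ 2 ^ s ⋆ b) ⊕ r         ≡⟨ cong (_⊕ r) (sym (⋆-distribʳ-⊕ q (2 ^ s) b)) ⟩
  (q ⊕ 2 ^ s) ⋆ b ⊕ r             ∎) , r<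
  where open ≡-Reasoning

cldivmodF-isDivMod : ∀ f a {b} → 0 < b → a ≤ f → IsDivMod a b (cldivmodF f a b)
cldivmodF-isDivMod zero    zero    {b}     _   _ = sym (cong (_⊕ 0) (⋆-zeroˡ b)) , m^n>0 2 (degree b)
cldivmodF-isDivMod (suc f) zero    {suc b} _   _ = sym (cong (_⊕ 0) (⋆-zeroˡ (suc b))) , m^n>0 2 (degree (suc b))
cldivmodF-isDivMod (suc f) (suc a) {suc b} 0<b (s≤s a≤f) with degree (suc a) <ᵇ degree (suc b) in lt
... | true  = sym (trans (cong (_⊕ suc a) (⋆-zeroˡ (suc b))) (⊕-identityˡ (suc a))) ,
  <-≤-trans (proj₂ (degree-bounds (suc a) z<s)) (^-monoʳ-≤ 2 (<ᵇ⇒< (degree (suc a)) (degree (suc b)) (subst T (sym lt) _)))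
... | false = isDivMod-shift {suc a} {suc b} {proj₁ qr} {proj₂ qr} s
  (cldivmodF-isDivMod f (suc a ⊕ suc b * 2 ^ s) 0<b (≤-pred (<-≤-trans shrinks (s≤s a≤f))))
  where
  s : ℕ
  s = degree (suc a) ∸ degree (suc b)
  qr : ℕ × ℕ
  qr = cldivmodF f (suc a ⊕ suc b * 2 ^ s) (suc b)
  shrinks : suc a ⊕ suc b * 2 ^ s < suc a
  shrinks = <-≤-trans (⊕-shift-<-2^degree {suc a} z<s 0<b (≮⇒≥ (λ p → subst T lt (<⇒<ᵇ p))))
                      (proj₁ (degree-bounds (suc a) z<s))

÷-mod-isDivMod : ∀ a {b} → 0 < b → IsDivMod a b (a ÷ b , a mod b)
÷-mod-isDivMod a 0<b = cldivmodF-isDivMod a a 0<b ≤-refl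

÷-mod-identity : ∀ a {b} → 0 < b → a ≡ (a ÷ b) ⋆ b ⊕ a mod b
÷-mod-identity a 0<b = proj₁ (÷-mod-isDivMod a 0<b)

mod-<-2^degree : ∀ a {b} → 0 < b → a mod b < 2 ^ degree b
mod-<-2^degree a 0<b = proj₂ (÷-mod-isDivMod a 0<b)

mod-2^-< : ∀ a k → a mod 2 ^ k < 2 ^ k
mod-2^-< a k = subst (λ d → a mod 2 ^ k < 2 ^ d) (⌊log₂[2^n]⌋≡n k) (mod-<-2^degree a (m^n>0 2 k))

mod-unique : ∀ {a b q r} → 0 < b → IsDivMod a b (q , r) → a mod b ≡ r
mod-unique {a} {b} {q} {r} 0<b (a≡ , r<) = inverseˡ-unique (a mod b) r (begin
  a mod b ⊕ r    ≡⟨ sym d⋆b≡m⊕r ⟩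
  d ⋆ b          ≡⟨ ⋆-<-2^degree⇒≡0 0<b (subst (_< 2 ^ degree b) (sym d⋆b≡m⊕r) (⊕-<-2^ (degree b) (mod-<-2^degree a 0<b) r<)) ⟩
  0              ∎)
  where
  open ≡-Reasoning
  d : ℕ
  d = a ÷ b ⊕ q
  d⋆b≡m⊕r : d ⋆ b ≡ a mod b ⊕ r
  d⋆b≡m⊕r = inverseˡ-unique (d ⋆ b) (a mod b ⊕ r) (begin
    d ⋆ b ⊕ (a mod b ⊕ r)                  ≡⟨ cong (_⊕ (a mod b ⊕ r)) (⋆-distribʳ-⊕ (a ÷ b) q b) ⟩
    (a ÷ b ⋆ b ⊕ q ⋆ b) ⊕ (a mod b ⊕ r)    ≡⟨ interchange (a ÷ b ⋆ b) (q ⋆ b) (a mod b) r ⟩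
    (a ÷ b ⋆ b ⊕ a mod b) ⊕ (q ⋆ b ⊕ r)    ≡⟨ cong₂ _⊕_ (sym (÷-mod-identity a 0<b)) (sym a≡) ⟩
    a ⊕ a                                  ≡⟨ ⊕-self a ⟩
    0                                      ∎)

-- Reduction modulo 2 ^ k ⊕ r

2^k≤2^k⊕r : ∀ k {r} → r < 2 ^ k → 2 ^ k ≤ 2 ^ k ⊕ r
2^k≤2^k⊕r k {r} r< = subst (2 ^ k ≤_) (⊕-comm r (2 ^ k)) (⊕-≥-2^ k r< ≤-refl)

degree-2^k⊕r : ∀ k {r} → r < 2 ^ k → degree (2 ^ k ⊕ r) ≡ k
degree-2^k⊕r k r< = degree-unique (2^k≤2^k⊕r k r<) (⊕-<-2^ (suc k) 2^k<2^[1+k] (<-trans r< 2^k<2^[1+k]))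
  where
  2^k<2^[1+k] : 2 ^ k < 2 ^ suc k
  2^k<2^[1+k] = ^-monoʳ-< 2 (s≤s (s≤s z≤n)) (n<1+n k)

mod-2^k⊕r : ∀ k r → r < 2 ^ k → (x : ℕ) →
    let p = 2 ^ k ⊕ r
        z = (x ÷ 2 ^ k) ⋆ r
    in x mod p ≡ (((z ÷ 2 ^ k) ⋆ 2 ^ k) mod p) ⊕ (z mod 2 ^ k) ⊕ (x mod 2 ^ k)
mod-2^k⊕r k r r< x = mod-unique 0<p (x≡ , remainder<)
  where
  D p xh xl z zl w wq wm : ℕ
  D = 2 ^ k
  p = D ⊕ r
  0<D : 0 < D
  0<D = m^n>0 2 k
  0<p : 0 < p
  0<p = <-≤-trans 0<D (2^k≤2^k⊕r k r<)
  xh = x ÷ D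
  xl = x mod D
  z = xh ⋆ r
  zl = z mod D
  w = (z ÷ D) ⋆ D
  wq = w ÷ p
  wm = w mod p
  remainder< : (wm ⊕ zl) ⊕ xl < 2 ^ degree p
  remainder< = subst (λ d → (wm ⊕ zl) ⊕ xl < 2 ^ d) (sym (degree-2^k⊕r k r<))
    (⊕-<-2^ k (⊕-<-2^ k (subst (λ d → wm < 2 ^ d) (degree-2^k⊕r k r<) (mod-<-2^degree w 0<p)) (mod-2^-< z k)) (mod-2^-< x k))
  x≡ : x ≡ (xh ⊕ wq) ⋆ p ⊕ ((wm ⊕ zl) ⊕ xl)
  x≡ = begin
    x                                         ≡⟨ ÷-mod-identity x 0<D ⟩
    xh ⋆ D ⊕ xl                               ≡⟨ cong (_⊕ xl) (sym (//-rightDividesʳ z (xh ⋆ D))) ⟩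
    ((xh ⋆ D ⊕ z) ⊕ z) ⊕ xl                   ≡⟨ cong (λ t → (t ⊕ z) ⊕ xl) (sym (⋆-distribˡ-⊕ xh D r)) ⟩
    (xh ⋆ p ⊕ z) ⊕ xl                         ≡⟨ cong (λ t → (xh ⋆ p ⊕ t) ⊕ xl) (÷-mod-identity z 0<D) ⟩
    (xh ⋆ p ⊕ (w ⊕ zl)) ⊕ xl                  ≡⟨ cong (λ t → (xh ⋆ p ⊕ (t ⊕ zl)) ⊕ xl) (÷-mod-identity w 0<p) ⟩
    (xh ⋆ p ⊕ ((wq ⋆ p ⊕ wm) ⊕ zl)) ⊕ xl      ≡⟨ cong (λ t → (xh ⋆ p ⊕ t) ⊕ xl) (⊕-assoc (wq ⋆ p) wm zl) ⟩
    (xh ⋆ p ⊕ (wq ⋆ p ⊕ (wm ⊕ zl))) ⊕ xl      ≡⟨ cong (_⊕ xl) (sym (⊕-assoc (xh ⋆ p) (wq ⋆ p) (wm ⊕ zl))) ⟩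
    ((xh ⋆ p ⊕ wq ⋆ p) ⊕ (wm ⊕ zl)) ⊕ xl      ≡⟨ ⊕-assoc (xh ⋆ p ⊕ wq ⋆ p) (wm ⊕ zl) xl ⟩
    (xh ⋆ p ⊕ wq ⋆ p) ⊕ ((wm ⊕ zl) ⊕ xl)      ≡⟨ cong (_⊕ ((wm ⊕ zl) ⊕ xl)) (sym (⋆-distribʳ-⊕ xh wq p)) ⟩
    (xh ⊕ wq) ⋆ p ⊕ ((wm ⊕ zl) ⊕ xl)          ∎
    where open ≡-Reasoning

lemma6 : (r : ℕ) → r < 2 ^ 64 → (x : ℕ) →
    let p = 2 ^ 64 ⊕ r
        z = (x ÷ 2 ^ 64) ⋆ r
    in x mod p ≡ (((z ÷ 2 ^ 64) ⋆ 2 ^ 64) mod p) ⊕ (z mod 2 ^ 64) ⊕ (x mod 2 ^ 64)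
lemma6 = mod-2^k⊕r 64
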